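{- Each of the following graphs is a transparent rectangle visibility graph (TRVG): (i) every (finite) threshold graph; (ii) every (finite) tree; (iii) every cycle $C_n$ ($n\ge 3$); (iv) the infinite rectangular grid graph; (v) the infinite triangular grid graph; (vi) the infinite hexagonal grid graph.
   Context: A graph $G$ is a transparent rectangle visibility graph (TRVG) if there is a collection of rectangles in the plane with sides parallel to the coordinate axes and pairwise disjoint interiors, one rectangle $R_v$ for each vertex $v$ (the collection is infinite when $G$ is infinite), such that for distinct vertices $u,v$: $u$ and $v$ are adjacent if and only if there is a horizontal or a vertical line meeting the interiors of both $R_u$ and $R_v$ (other rectangles lying between them do not block visibility). A threshold graph is a graph obtainable from the one-vertex graph by repeatedly adding either an isolated vertex or a universal vertex (a new vertex adjacent to all existing vertices). The infinite rectangular grid graph has vertex set $\mathbb{Z}^2$, with $(i,j)$ adjacent to $(i',j')$ iff $|i-i'|+|j-j'|=1$. The infinite triangular grid graph has vertex set $\{v_{i,j}: i,j\in\mathbb{Z}\}$, where $v_{i,j}$ is adjacent exactly to $v_{i-1,j}, v_{i+1,j}, v_{i,j-1}, v_{i+1,j-1}, v_{i-1,j+1}, v_{i,j+1}$ (the graph of the tiling of the plane by equilateral triangles). The infinite hexagonal grid graph is the graph of the tiling of the plane by regular hexagons (honeycomb lattice): vertices are the corners of the hexagons and edges are the hexagon sides. -}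

module Defs where

open import Data.Nat as ℕ using (ℕ; zero; suc)
open import Data.Integer as ℤ using (ℤ; ∣_∣)
open import Data.Rational as ℚ using (ℚ)
open import Data.Fin using (Fin; toℕ) renaming (zero to fzero; suc to fsuc)
open import Data.Vec using (Vec; lookup)
open import Data.Bool using (Bool; true; false; T)
open import Data.List using (List; []; _∷_)
open import Data.List.Relation.Unary.Unique.Propositional using (Unique)
open import Data.Product using (Σ; ∃; ∃-syntax; _×_; _,_)
open import Data.Sum using (_⊎_)
open import Data.Unit using (⊤)
open import Relation.Nullary using (¬_)
open import Relation.Binary.PropositionalEquality using (_≡_; _≢_)
open import Function.Bundles using (_⇔_; _↔_; Inverse)

record Graph : Set₁ where
  field
    V     : Set
    Adj   : V → V → Set
    sym   : ∀ {u v} → Adj u v → Adj v u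
    irrefl : ∀ {v} → ¬ Adj v v

record Rect : Set where
  field
    x₁ x₂ y₁ y₂ : ℚ
    x₁<x₂ : x₁ ℚ.< x₂
    y₁<y₂ : y₁ ℚ.< y₂

open Rect public

InX : Rect → ℚ → Set
InX R x = (x₁ R ℚ.< x) × (x ℚ.< x₂ R)

InY : Rect → ℚ → Set
InY R y = (y₁ R ℚ.< y) × (y ℚ.< y₂ R)

InInterior : Rect → ℚ → ℚ → Set
InInterior R x y = InX R x × InY R y

DisjointInteriors : Rect → Rect → Set
DisjointInteriors R S = ¬ (∃[ x ] ∃[ y ] (InInterior R x y × InInterior S x y))

-- some horizontal line (y = const) or vertical line (x = const) meets
-- the interiors of both rectangles
Sees : Rect → Rect → Set
Sees R S = (∃[ y ] (InY R y × InY S y)) ⊎ (∃[ x ] (InX R x × InX S x))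

IsTRVG : (V : Set) → (V → V → Set) → Set
IsTRVG V Adj = Σ (V → Rect) λ R →
                  (∀ u v → u ≢ v → DisjointInteriors (R u) (R v))
                × (∀ u v → u ≢ v → (Adj u v ⇔ Sees (R u) (R v)))

TRVG : Graph → Set
TRVG G = IsTRVG (Graph.V G) (Graph.Adj G)

_≅_ : Graph → Graph → Set
G ≅ H = Σ (Graph.V G ↔ Graph.V H) λ f →
          ∀ u v → Graph.Adj G u v ⇔ Graph.Adj H (Inverse.to f u) (Inverse.to f v)

-- A sequence b of n bits describes the graph on
-- Fin (suc n): vertex 0 is the initial vertex, vertex (suc k) is added at
-- step k, as a universal vertex if b_k = true, isolated if b_k = false.

bitAt : ∀ {n} → Vec Bool n → Fin (suc n) → Bool
bitAt b fzero    = false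
bitAt b (fsuc k) = lookup b k

ThresholdAdj : ∀ {n} → Vec Bool n → Fin (suc n) → Fin (suc n) → Set
ThresholdAdj b i j = (toℕ i ℕ.< toℕ j × T (bitAt b j))
                   ⊎ (toℕ j ℕ.< toℕ i × T (bitAt b i))

thresholdSym : ∀ {n} (b : Vec Bool n) {i j} → ThresholdAdj b i j → ThresholdAdj b j i
thresholdSym b (Data.Sum.inj₁ p) = Data.Sum.inj₂ p
thresholdSym b (Data.Sum.inj₂ p) = Data.Sum.inj₁ p

thresholdIrr : ∀ {n} (b : Vec Bool n) {i} → ¬ ThresholdAdj b i i
thresholdIrr b (Data.Sum.inj₁ (p , _)) = Data.Nat.Properties.<-irrefl _≡_.refl p
  where import Data.Nat.Properties
thresholdIrr b (Data.Sum.inj₂ (p , _)) = Data.Nat.Properties.<-irrefl _≡_.refl p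
  where import Data.Nat.Properties

ThresholdGraph : ∀ {n} → Vec Bool n → Graph
ThresholdGraph {n} b = record
  { V = Fin (suc n) ; Adj = ThresholdAdj b
  ; sym = thresholdSym b ; irrefl = thresholdIrr b }

IsThreshold : Graph → Set
IsThreshold G = ∃[ n ] ∃[ b ] (G ≅ ThresholdGraph {n} b)

IsFinite : Graph → Set
IsFinite G = ∃[ n ] (Graph.V G ↔ Fin n)

module _ (G : Graph) where
  open Graph G

  data Walk : V → V → Set where
    here : ∀ {v} → Walk v v
    step : ∀ {u w v} → Adj u w → Walk w v → Walk u v

  Connected : Set
  Connected = ∀ u v → Walk u v

  Chain : V → List V → Set
  Chain v []       = ⊤
  Chain v (w ∷ ws) = Adj v w × Chain w ws

  lastOf : V → List V → V
  lastOf v []       = v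
  lastOf v (w ∷ ws) = lastOf w ws

  HasCycle : Set
  HasCycle = ∃[ v₀ ] ∃[ v₁ ] ∃[ v₂ ] ∃[ vs ]
               ( Unique (v₀ ∷ v₁ ∷ v₂ ∷ vs)
               × Chain v₀ (v₁ ∷ v₂ ∷ vs)
               × Adj (lastOf v₂ vs) v₀ )

  Acyclic : Set
  Acyclic = ¬ HasCycle

  IsTree : Set
  IsTree = Connected × Acyclic

CycleAdj : (n : ℕ) → Fin n → Fin n → Set
CycleAdj n i j = (i ≢ j) × (  (suc (toℕ i) ≡ toℕ j) ⊎ (suc (toℕ j) ≡ toℕ i)
                            ⊎ ((toℕ i ≡ 0) × (suc (toℕ j) ≡ n))
                            ⊎ ((toℕ j ≡ 0) × (suc (toℕ i) ≡ n)) )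

Cycle : ℕ → Graph
Cycle n = record
  { V = Fin n ; Adj = CycleAdj n
  ; sym = λ { (ne , Data.Sum.inj₁ p) → (λ e → ne (Relation.Binary.PropositionalEquality.sym e)) , Data.Sum.inj₂ (Data.Sum.inj₁ p)
            ; (ne , Data.Sum.inj₂ (Data.Sum.inj₁ p)) → (λ e → ne (Relation.Binary.PropositionalEquality.sym e)) , Data.Sum.inj₁ p
            ; (ne , Data.Sum.inj₂ (Data.Sum.inj₂ (Data.Sum.inj₁ p))) → (λ e → ne (Relation.Binary.PropositionalEquality.sym e)) , Data.Sum.inj₂ (Data.Sum.inj₂ (Data.Sum.inj₂ p))
            ; (ne , Data.Sum.inj₂ (Data.Sum.inj₂ (Data.Sum.inj₂ p))) → (λ e → ne (Relation.Binary.PropositionalEquality.sym e)) , Data.Sum.inj₂ (Data.Sum.inj₂ (Data.Sum.inj₁ p)) }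
  ; irrefl = λ { (ne , _) → ne _≡_.refl } }
  where import Relation.Binary.PropositionalEquality

ℤ² : Set
ℤ² = ℤ × ℤ

diff : ℤ² → ℤ² → ℤ²
diff (i , j) (i' , j') = (i' ℤ.- i , j' ℤ.- j)

GridAdj : ℤ² → ℤ² → Set
GridAdj (i , j) (i' , j') = ∣ i ℤ.- i' ∣ ℕ.+ ∣ j ℤ.- j' ∣ ≡ 1

TriAdj : ℤ² → ℤ² → Set
TriAdj p q = (diff p q ≡ (ℤ.+ 1 , ℤ.+ 0)) ⊎ (diff p q ≡ (ℤ.- ℤ.+ 1 , ℤ.+ 0))
           ⊎ (diff p q ≡ (ℤ.+ 0 , ℤ.- ℤ.+ 1)) ⊎ (diff p q ≡ (ℤ.+ 1 , ℤ.- ℤ.+ 1))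
           ⊎ (diff p q ≡ (ℤ.- ℤ.+ 1 , ℤ.+ 1)) ⊎ (diff p q ≡ (ℤ.+ 0 , ℤ.+ 1))

-- infinite hexagonal grid (honeycomb), in "brick wall" coordinates:
-- (i,j) ~ (i±1,j) always, and (i,j) ~ (i,j+1) iff i + j is even.
IsEven : ℤ → Set
IsEven z = ∃[ k ] (z ≡ k ℤ.+ k)

HexAdj : ℤ² → ℤ² → Set
HexAdj p@(i , j) q =
    (diff p q ≡ (ℤ.+ 1 , ℤ.+ 0)) ⊎ (diff p q ≡ (ℤ.- ℤ.+ 1 , ℤ.+ 0))
  ⊎ ((diff p q ≡ (ℤ.+ 0 , ℤ.+ 1)) × IsEven (i ℤ.+ j))
  ⊎ ((diff p q ≡ (ℤ.+ 0 , ℤ.- ℤ.+ 1)) × IsEven (i ℤ.+ j ℤ.- ℤ.+ 1))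

{-# OPTIONS --safe #-}
module Submission where

-- Every graph is drawn with vertex v as the rectangle X v × Y v, where X v and Y v are
-- integer intervals, each lying on an integer lane, and distinct lanes are laid out
-- disjointly in ℚ.  Two rectangles then see each other iff their X- or their Y-intervals
-- share a lane and overlap, and their interiors are disjoint unless both happen at once.
-- Threshold graphs: all X-intervals on one lane, a universal vertex stretching back over
-- all earlier ones.  Cycles: a staircase of X-intervals overlapping their successors, with
-- the closing edge on a shared Y-lane.  Trees: root and 2-colour by depth parity; each
-- vertex is full length on its own lane in one direction and a unit interval on its
-- parent's lane in the other, so exactly the parent edges become visibilities.  Lattices:
-- rows and columns are lanes; for the hexagonal grid the vertical edges pair up vertices
-- on a column lane, for the triangular grid two consecutive rows share a lane.

open import Defs
open import Data.Bool using (Bool; true; false; not; T)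
import Data.Bool.Properties as BoolP
open import Data.Empty using (⊥; ⊥-elim)
open import Data.Fin using (Fin; toℕ) renaming (zero to fzero)
import Data.Fin.Properties as FinP
open import Data.Integer as ℤ using (ℤ; +_; -[1+_]; +<+; -<+; -<-; _+_; _-_; -_; _*_; ∣_∣; _⊔_; _⊓_)
import Data.Integer.Properties as ℤP
open import Data.Integer.Tactic.RingSolver using (solve-∀)
open import Data.List using (List; []; _∷_; _++_; length; _ʳ++_)
open import Data.List.Membership.Propositional using (_∈_; _∉_)
open import Data.List.Membership.Propositional.Properties using (∈-++⁺ˡ)
open import Data.List.Properties using (∷-injectiveˡ; ∷-injectiveʳ)
open import Data.List.Relation.Unary.All as All using (All; []; _∷_)
open import Data.List.Relation.Unary.All.Properties using (¬Any⇒All¬; All¬⇒¬Any; ++⁻ˡ)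
open import Data.List.Relation.Unary.AllPairs using ([]; _∷_)
open import Data.List.Relation.Unary.Any using (here; there)
open import Data.List.Relation.Unary.Unique.Propositional using (Unique)
import Data.List.Relation.Unary.Unique.Propositional.Properties as Unique
open import Data.Nat as ℕ using (ℕ; zero; suc; s≤s; z≤n; _∸_; _≥_; ⌊_/2⌋; ⌈_/2⌉)
import Data.Nat.Properties as ℕP
open import Data.Product using (∃-syntax; _×_; _,_; proj₁; proj₂)
open import Data.Product.Function.NonDependent.Propositional using (_×-⇔_)
open import Data.Rational as ℚ using (ℚ; 1ℚ)
import Data.Rational.Properties as ℚP
open import Data.Sum as Sum using (_⊎_; inj₁; inj₂)
open import Data.Sum.Function.Propositional using (_⊎-⇔_)
open import Data.Unit using (tt)
open import Data.Vec using (Vec)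
open import Function.Base using (flip; _∘_)
open import Function.Bundles using (_⇔_; mk⇔; _↔_; Equivalence; Inverse; Injection)
import Function.Properties.Equivalence as ⇔
open import Function.Properties.Inverse using (↔⇒↣)
open import Relation.Binary.Core using (Rel; _Preserves_⟶_)
open import Relation.Binary.Definitions using (DecidableEquality; Transitive; tri<; tri≈; tri>)
open import Relation.Binary.PropositionalEquality
  using (_≡_; _≢_; refl; sym; trans; cong; cong₂; subst; subst₂; module ≡-Reasoning)
open import Relation.Nullary using (¬_; Dec; yes; no)
open import Relation.Nullary.Decidable using (via-injection)

stepwise⇒monotone : ∀ {ℓ} {A : Set} {R : Rel A ℓ} → Transitive R → (f : ℕ → A) →
                    (∀ n → R (f n) (f (suc n))) → ∀ {m n} → m ℕ.< n → R (f m) (f n)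
stepwise⇒monotone {R = R} R-trans f next {m} {suc n} m<1+n with ℕP.m≤n⇒m<n∨m≡n (ℕP.≤-pred m<1+n)
... | inj₁ m<n  = R-trans {f m} {f n} (stepwise⇒monotone {R = R} R-trans f next {m} {n} m<n) (next n)
... | inj₂ refl = next n

module ℤ↪Interval {a b : ℚ} (a<b : a ℚ.< b) where

  private
    Between : ℚ → ℚ → Set
    Between p q = ∃[ r ] (p ℚ.< r × r ℚ.< q)

    higher lower : ∀ {p q} → Between p q → Between p q
    higher (r , p<r , r<q) with ℚP.<-dense r<q
    ... | s , r<s , s<q = s , ℚP.<-trans p<r r<s , s<q
    lower (r , p<r , r<q) with ℚP.<-dense p<r
    ... | s , p<s , s<r = s , p<s , ℚP.<-trans s<r r<q

    higher-> : ∀ {p q} (x : Between p q) → proj₁ x ℚ.< proj₁ (higher x)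
    higher-> (r , _ , r<q) = proj₁ (proj₂ (ℚP.<-dense r<q))

    lower-< : ∀ {p q} (x : Between p q) → proj₁ (lower x) ℚ.< proj₁ x
    lower-< (r , p<r , _) = proj₂ (proj₂ (ℚP.<-dense p<r))

    mid : Between a b
    mid = ℚP.<-dense a<b

    m : ℚ
    m = proj₁ mid

    up : ℕ → Between m b
    up zero    = ℚP.<-dense (proj₂ (proj₂ mid))
    up (suc n) = higher (up n)

    down : ℕ → Between a m
    down zero    = ℚP.<-dense (proj₁ (proj₂ mid))
    down (suc n) = lower (down n)

  embed : ℤ → ℚ
  embed (+ n)    = proj₁ (up n)
  embed -[1+ n ] = proj₁ (down n)

  embed-mono : embed Preserves ℤ._<_ ⟶ ℚ._<_
  embed-mono {+ m}      {+ n}      (+<+ m<n) =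
    stepwise⇒monotone {R = ℚ._<_} ℚP.<-trans (proj₁ ∘ up) (higher-> ∘ up) {m} {n} m<n
  embed-mono { -[1+ m ]} {+ n}      -<+       = ℚP.<-trans (proj₂ (proj₂ (down m))) (proj₁ (proj₂ (up n)))
  embed-mono { -[1+ m ]} { -[1+ n ]} (-<- n<m) =
    stepwise⇒monotone {R = ℚ._>_} (flip ℚP.<-trans) (proj₁ ∘ down) (lower-< ∘ down) {n} {m} n<m

  embed-bounds : ∀ t → a ℚ.< embed t × embed t ℚ.< b
  embed-bounds (+ n)    = ℚP.<-trans (proj₁ (proj₂ mid)) (proj₁ (proj₂ (up n))) , proj₂ (proj₂ (up n))
  embed-bounds -[1+ n ] = proj₁ (proj₂ (down n)) , ℚP.<-trans (proj₂ (proj₂ (down n))) (proj₂ (proj₂ mid))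

strict⇒≤-mono : ∀ {f : ℤ → ℚ} → f Preserves ℤ._<_ ⟶ ℚ._<_ → f Preserves ℤ._≤_ ⟶ ℚ._≤_
strict⇒≤-mono {f} mono {s} {t} s≤t with ℤP.<-cmp s t
... | tri< s<t _ _ = ℚP.<⇒≤ (mono s<t)
... | tri≈ _ refl _ = ℚP.≤-refl
... | tri> _ _ t<s = ⊥-elim (ℤP.<-irrefl refl (ℤP.<-≤-trans t<s s≤t))

laneBase : ℤ → ℚ
laneBase = ℤ↪Interval.embed (ℚP.positive⁻¹ 1ℚ)

laneBase-mono : laneBase Preserves ℤ._<_ ⟶ ℚ._<_
laneBase-mono = ℤ↪Interval.embed-mono (ℚP.positive⁻¹ 1ℚ)

laneBase-gap : ∀ L → laneBase L ℚ.< laneBase (ℤ.suc L)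
laneBase-gap L = laneBase-mono (ℤP.suc[i]≤j⇒i<j {L} ℤP.≤-refl)

-- A lane is unbounded both ways, hence an order embedding of ℤ into the gap up to the next lane.
coord : ℤ → ℤ → ℚ
coord L = ℤ↪Interval.embed (laneBase-gap L)

coord-mono : ∀ L → coord L Preserves ℤ._<_ ⟶ ℚ._<_
coord-mono L = ℤ↪Interval.embed-mono (laneBase-gap L)

coord-bounds : ∀ L t → laneBase L ℚ.< coord L t × coord L t ℚ.< laneBase (ℤ.suc L)
coord-bounds L = ℤ↪Interval.embed-bounds (laneBase-gap L)

coord-<-lanes : ∀ {L L'} t t' → L ℤ.< L' → coord L t ℚ.< coord L' t'
coord-<-lanes {L} {L'} t t' L<L' = begin-strict
  coord L t          <⟨ proj₂ (coord-bounds L t) ⟩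
  laneBase (ℤ.suc L) ≤⟨ strict⇒≤-mono laneBase-mono (ℤP.i<j⇒suc[i]≤j L<L') ⟩
  laneBase L'        <⟨ proj₁ (coord-bounds L' t') ⟩
  coord L' t'        ∎
  where open ℚP.≤-Reasoning

coord-<⁻¹ : ∀ {L L' t t'} → coord L t ℚ.< coord L' t' → L ℤ.< L' ⊎ (L ≡ L' × t ℤ.< t')
coord-<⁻¹ {L} {L'} {t} {t'} lt with ℤP.<-cmp L L'
... | tri< L<L' _ _ = inj₁ L<L'
... | tri> _ _ L'<L = ⊥-elim (ℚP.<-asym lt (coord-<-lanes t' t L'<L))
... | tri≈ _ refl _ with ℤP.<-cmp t t'
...   | tri< t<t' _ _ = inj₂ (refl , t<t')
...   | tri≈ _ refl _ = ⊥-elim (ℚP.<-irrefl refl lt)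
...   | tri> _ _ t'<t = ⊥-elim (ℚP.<-asym lt (coord-mono L t'<t))

record Interval : Set where
  constructor interval
  field
    lane lo hi : ℤ
    lo<hi      : lo ℤ.< hi

open Interval

Overlap : Interval → Interval → Set
Overlap I J = lane I ≡ lane J × lo I ℤ.< hi J × lo J ℤ.< hi I

overlap-sym : ∀ {I J} → Overlap I J → Overlap J I
overlap-sym (same , p , q) = sym same , q , p

lower upper : Interval → ℚ
lower I = coord (lane I) (lo I)
upper I = coord (lane I) (hi I)

Inside : Interval → ℚ → Set
Inside I x = lower I ℚ.< x × x ℚ.< upper I

⊔<⊓ : ∀ {a b c d} → a ℤ.< c → a ℤ.< d → b ℤ.< c → b ℤ.< d → a ⊔ b ℤ.< c ⊓ d
⊔<⊓ {a} {b} {c} {d} a<c a<d b<c b<d with ℤP.⊔-sel a b | ℤP.⊓-sel c d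
... | inj₁ eq | inj₁ eq' rewrite eq | eq' = a<c
... | inj₁ eq | inj₂ eq' rewrite eq | eq' = a<d
... | inj₂ eq | inj₁ eq' rewrite eq | eq' = b<c
... | inj₂ eq | inj₂ eq' rewrite eq | eq' = b<d

overlap⇒common-point : ∀ I J → Overlap I J → ∃[ x ] (Inside I x × Inside J x)
overlap⇒common-point (interval L a b a<b) (interval .L a' b' a'<b') (refl , a<b' , a'<b)
  with ℚP.<-dense (coord-mono L (⊔<⊓ a<b a<b' a'<b a'<b'))
... | x , m<x , x<M =
  x , (bound (ℤP.i≤i⊔j a a') m<x , bound' (ℤP.i⊓j≤i b b') x<M)
    , (bound (ℤP.i≤j⊔i a a') m<x , bound' (ℤP.i⊓j≤j b b') x<M)
  where
  bound : ∀ {s t} → s ℤ.≤ t → coord L t ℚ.< x → coord L s ℚ.< x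
  bound s≤t = ℚP.≤-<-trans (strict⇒≤-mono (coord-mono L) s≤t)
  bound' : ∀ {s t} → s ℤ.≤ t → x ℚ.< coord L s → x ℚ.< coord L t
  bound' s≤t x<s = ℚP.<-≤-trans x<s (strict⇒≤-mono (coord-mono L) s≤t)

common-point⇒overlap : ∀ I J → ∃[ x ] (Inside I x × Inside J x) → Overlap I J
common-point⇒overlap (interval L a b _) (interval L' a' b' _) (x , (a<x , x<b) , (a'<x , x<b'))
  with coord-<⁻¹ {L} {L'} {a} {b'} (ℚP.<-trans a<x x<b')
     | coord-<⁻¹ {L'} {L} {a'} {b} (ℚP.<-trans a'<x x<b)
... | inj₁ lt           | inj₁ gt           = ⊥-elim (ℤP.<-asym lt gt)
... | inj₁ lt           | inj₂ (refl , _)   = ⊥-elim (ℤP.<-irrefl refl lt)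
... | inj₂ (refl , _)   | inj₁ gt           = ⊥-elim (ℤP.<-irrefl refl gt)
... | inj₂ (refl , p)   | inj₂ (_ , q)      = refl , p , q

rectangle : Interval → Interval → Rect
rectangle I J = record
  { x₁ = lower I ; x₂ = upper I ; y₁ = lower J ; y₂ = upper J
  ; x₁<x₂ = coord-mono (lane I) (lo<hi I) ; y₁<y₂ = coord-mono (lane J) (lo<hi J) }

-- Overlapping ys give a horizontal line of sight, overlapping xs a vertical one.
record IntervalModel (V : Set) (Adj : V → V → Set) : Set where
  field
    xs ys     : V → Interval
    separated : ∀ u v → u ≢ v → Overlap (xs u) (xs v) → Overlap (ys u) (ys v) → ⊥
    adjacent⇔ : ∀ u v → u ≢ v → Adj u v ⇔ (Overlap (ys u) (ys v) ⊎ Overlap (xs u) (xs v))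

intervalModel⇒TRVG : ∀ {V Adj} → IntervalModel V Adj → IsTRVG V Adj
intervalModel⇒TRVG {V} {Adj} M = R , disjoint , visible
  where
  open IntervalModel M
  R : V → Rect
  R v = rectangle (xs v) (ys v)
  disjoint : ∀ u v → u ≢ v → DisjointInteriors (R u) (R v)
  disjoint u v u≢v (x , y , (xu , yu) , (xv , yv)) =
    separated u v u≢v (common-point⇒overlap (xs u) (xs v) (x , xu , xv))
                      (common-point⇒overlap (ys u) (ys v) (y , yu , yv))
  sees⇔ : ∀ u v → (Overlap (ys u) (ys v) ⊎ Overlap (xs u) (xs v)) ⇔ Sees (R u) (R v)
  sees⇔ u v = mk⇔
    (Sum.map (overlap⇒common-point (ys u) (ys v)) (overlap⇒common-point (xs u) (xs v)))
    (Sum.map (common-point⇒overlap (ys u) (ys v)) (common-point⇒overlap (xs u) (xs v)))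
  visible : ∀ u v → u ≢ v → Adj u v ⇔ Sees (R u) (R v)
  visible u v u≢v = ⇔.trans (adjacent⇔ u v u≢v) (sees⇔ u v)

TRVG-transport : ∀ {V W : Set} {A : V → V → Set} {B : W → W → Set} (f : V ↔ W) →
                 (∀ u v → A u v ⇔ B (Inverse.to f u) (Inverse.to f v)) → IsTRVG W B → IsTRVG V A
TRVG-transport f A⇔B (R , disjoint , visible) =
    (λ v → R (to v))
  , (λ u v u≢v → disjoint (to u) (to v) (u≢v ∘ injective))
  , (λ u v u≢v → ⇔.trans (A⇔B u v) (visible (to u) (to v) (u≢v ∘ injective)))
  where
  open Inverse f using (to)
  open Injection (↔⇒↣ f) using (injective)

subst-⇔ : ∀ {A : Set} (P : A → Set) {x y} → x ≡ y → P x ⇔ P y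
subst-⇔ P refl = ⇔.refl

offset≡ : ∀ {z d a b} → z ≡ a → z + d ≡ b → d ≡ b - a
offset≡ {z} {d} refl refl = solve z d
  where
  solve : ∀ z d → d ≡ z + d - z
  solve = solve-∀

∣∣<⇔ : ∀ d w → ∣ d ∣ ℕ.< w ⇔ (- + w ℤ.< d × d ℤ.< + w)
∣∣<⇔ (+ n) w = mk⇔ (λ n<w → -w<+n n<w , +<+ n<w) (λ { (_ , +<+ n<w) → n<w })
  where
  -w<+n : ∀ {n w} → n ℕ.< w → - + w ℤ.< + n
  -w<+n {w = suc w} _ = -<+
∣∣<⇔ -[1+ n ] zero    = mk⇔ (λ ()) (λ { (() , _) })
∣∣<⇔ -[1+ n ] (suc w) = mk⇔ (λ { (s≤s n<w) → -<- n<w , -<+ }) (λ { (-<- n<w , _) → s≤s n<w })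

<+⇔-< : ∀ x y z → x ℤ.< y + z ⇔ x - y ℤ.< z
<+⇔-< x y z = mk⇔
  (λ x<y+z → subst (x - y ℤ.<_) (cancel y z) (ℤP.+-monoˡ-< (- y) x<y+z))
  (λ x-y<z → subst₂ ℤ._<_ (restore x y) (ℤP.+-comm z y) (ℤP.+-monoˡ-< y x-y<z))
  where
  cancel : ∀ y z → y + z - y ≡ z
  cancel = solve-∀
  restore : ∀ x y → x - y + y ≡ x
  restore = solve-∀

slot : (L p : ℤ) (w : ℕ) → .{{ℕ.NonZero w}} → Interval
slot L p w@(suc _) = interval L p (p + + w) p<p+w
  where
  p<p+w : p ℤ.< p + + w
  p<p+w = Equivalence.from (<+⇔-< p p (+ w))
            (subst (ℤ._< + w) (sym (ℤP.+-inverseʳ p)) (+<+ (s≤s z≤n)))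

neg-<-swap : ∀ a b → - a ℤ.< b → - b ℤ.< a
neg-<-swap a b -a<b = subst (- b ℤ.<_) (ℤP.neg-involutive a) (ℤP.neg-mono-< -a<b)

slot-overlap⇔ : ∀ L L' p p' w .{{_ : ℕ.NonZero w}} →
                Overlap (slot L p w) (slot L' p' w) ⇔ (L ≡ L' × ∣ p' - p ∣ ℕ.< w)
slot-overlap⇔ L L' p p' w@(suc _) = mk⇔
  (λ (same , p<p'+w , p'<p+w) → same , Equivalence.from (∣∣<⇔ (p' - p) w) (lower⇒ p<p'+w , upper⇒ p'<p+w))
  (λ (same , close) → let (-w<d , d<w) = Equivalence.to (∣∣<⇔ (p' - p) w) close
                      in same , ⇒lower -w<d , ⇒upper d<w)
  where
  flip-sub : ∀ p p' → - (p' - p) ≡ p - p'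
  flip-sub = solve-∀
  upper⇒ : p' ℤ.< p + + w → p' - p ℤ.< + w
  upper⇒ = Equivalence.to (<+⇔-< p' p (+ w))
  ⇒upper : p' - p ℤ.< + w → p' ℤ.< p + + w
  ⇒upper = Equivalence.from (<+⇔-< p' p (+ w))
  lower⇒ : p ℤ.< p' + + w → - + w ℤ.< p' - p
  lower⇒ p<p'+w = neg-<-swap (p' - p) (+ w)
    (subst (ℤ._< + w) (sym (flip-sub p p')) (Equivalence.to (<+⇔-< p p' (+ w)) p<p'+w))
  ⇒lower : - + w ℤ.< p' - p → p ℤ.< p' + + w
  ⇒lower -w<d = Equivalence.from (<+⇔-< p p' (+ w))
    (subst (ℤ._< + w) (flip-sub p p') (neg-<-swap (+ w) (p' - p) -w<d))

≡+⇔≡0 : ∀ L b → L ≡ L + b ⇔ b ≡ + 0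
≡+⇔≡0 L b = mk⇔ (λ e → trans (offset≡ refl (sym e)) (ℤP.+-inverseʳ L))
                (λ { refl → sym (ℤP.+-identityʳ L) })

shifted-slot-overlap⇔ : ∀ L b p a w .{{_ : ℕ.NonZero w}} →
                        Overlap (slot L p w) (slot (L + b) (p + a) w) ⇔ (b ≡ + 0 × ∣ a ∣ ℕ.< w)
shifted-slot-overlap⇔ L b p a w = ⇔.trans (slot-overlap⇔ L (L + b) p (p + a) w) (≡+⇔≡0 L b ×-⇔ distance)
  where
  cancel : ∀ p a → p + a - p ≡ a
  cancel = solve-∀
  distance : ∣ p + a - p ∣ ℕ.< w ⇔ ∣ a ∣ ℕ.< w
  distance = subst-⇔ (λ x → ∣ x ∣ ℕ.< w) (cancel p a)

∣-∣<1⇔≡ : ∀ p q → ∣ q - p ∣ ℕ.< 1 ⇔ p ≡ q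
∣-∣<1⇔≡ p q = mk⇔
  (λ lt → sym (ℤP.i-j≡0⇒i≡j q p (ℤP.∣i∣≡0⇒i≡0 (ℕP.n<1⇒n≡0 lt))))
  (λ { refl → subst (λ x → ∣ x ∣ ℕ.< 1) (sym (ℤP.+-inverseʳ p)) (s≤s z≤n) })

natInterval : (L lo hi : ℕ) → lo ℕ.< hi → Interval
natInterval L lo hi lo<hi = interval (+ L) (+ lo) (+ hi) (+<+ lo<hi)

natInterval-overlap⇔ : ∀ {L L' lo lo' hi hi'} (p : lo ℕ.< hi) (p' : lo' ℕ.< hi') →
  Overlap (natInterval L lo hi p) (natInterval L' lo' hi' p') ⇔ (L ≡ L' × lo ℕ.< hi' × lo' ℕ.< hi)
natInterval-overlap⇔ _ _ = mk⇔
  (λ (same , lo<hi' , lo'<hi) → ℤP.+-injective same , ℤP.drop‿+<+ lo<hi' , ℤP.drop‿+<+ lo'<hi)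
  (λ (same , lo<hi' , lo'<hi) → cong +_ same , +<+ lo<hi' , +<+ lo'<hi)

unitAt : ℕ → Interval
unitAt L = natInterval L 0 1 (s≤s z≤n)

unitAt-overlap⇔ : ∀ {L L'} → Overlap (unitAt L) (unitAt L') ⇔ L ≡ L'
unitAt-overlap⇔ = mk⇔ (ℤP.+-injective ∘ proj₁) (λ same → cong +_ same , +<+ (s≤s z≤n) , +<+ (s≤s z≤n))

-- Threshold graphs

toℕ-≢ : ∀ {n} {u v : Fin n} → u ≢ v → toℕ u ≢ toℕ v
toℕ-≢ u≢v = u≢v ∘ FinP.toℕ-injective

reach : Bool → ℕ → ℕ
reach true  k = 0
reach false k = k

reach≤ : ∀ b k → reach b k ℕ.≤ k
reach≤ true  k = z≤n
reach≤ false k = ℕP.≤-refl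

reach<⇔T : ∀ b {k k'} → k ℕ.< k' → reach b k' ℕ.< suc k ⇔ T b
reach<⇔T true  _    = mk⇔ (λ _ → tt) (λ _ → s≤s z≤n)
reach<⇔T false k<k' = mk⇔ (λ k'<1+k → ℕP.<-irrefl refl (ℕP.<-≤-trans k<k' (ℕP.≤-pred k'<1+k))) (λ ())

thresholdModel : ∀ {n} (b : Vec Bool n) → IntervalModel (Fin (suc n)) (ThresholdAdj b)
thresholdModel {n} b = record { xs = xs ; ys = ys ; separated = separated ; adjacent⇔ = adjacent⇔ }
  where
  xs ys : Fin (suc n) → Interval
  xs k = natInterval 0 (reach (bitAt b k) (toℕ k)) (suc (toℕ k)) (s≤s (reach≤ (bitAt b k) (toℕ k)))
  ys k = unitAt (toℕ k)
  separated : ∀ u v → u ≢ v → Overlap (xs u) (xs v) → Overlap (ys u) (ys v) → ⊥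
  separated u v u≢v _ y-overlap = toℕ-≢ u≢v (Equivalence.to unitAt-overlap⇔ y-overlap)
  Reaches : Fin (suc n) → Fin (suc n) → Set
  Reaches u v = reach (bitAt b v) (toℕ v) ℕ.< suc (toℕ u)
  x-overlap⇔ : ∀ u v → Overlap (xs u) (xs v) ⇔ (Reaches v u × Reaches u v)
  x-overlap⇔ u v =
    ⇔.trans (natInterval-overlap⇔ (s≤s (reach≤ _ _)) (s≤s (reach≤ _ _))) (mk⇔ proj₂ (refl ,_))
  reaches-forward : ∀ {u v} → toℕ u ℕ.< toℕ v → Reaches v u
  reaches-forward u<v = s≤s (ℕP.≤-trans (reach≤ _ _) (ℕP.<⇒≤ u<v))
  adjacent⇔ : ∀ u v → u ≢ v → ThresholdAdj b u v ⇔ (Overlap (ys u) (ys v) ⊎ Overlap (xs u) (xs v))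
  adjacent⇔ u v u≢v = mk⇔ to from
    where
    to : ThresholdAdj b u v → Overlap (ys u) (ys v) ⊎ Overlap (xs u) (xs v)
    to (inj₁ (u<v , universal)) =
      inj₂ (Equivalence.from (x-overlap⇔ u v) (reaches-forward u<v , Equivalence.from (reach<⇔T _ u<v) universal))
    to (inj₂ (v<u , universal)) =
      inj₂ (Equivalence.from (x-overlap⇔ u v) (Equivalence.from (reach<⇔T _ v<u) universal , reaches-forward v<u))
    from : Overlap (ys u) (ys v) ⊎ Overlap (xs u) (xs v) → ThresholdAdj b u v
    from (inj₁ y-overlap) = ⊥-elim (toℕ-≢ u≢v (Equivalence.to unitAt-overlap⇔ y-overlap))
    from (inj₂ x-overlap) with Equivalence.to (x-overlap⇔ u v) x-overlap | ℕP.<-cmp (toℕ u) (toℕ v)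
    ... | _ , reaches-v | tri< u<v _ _ = inj₁ (u<v , Equivalence.to (reach<⇔T _ u<v) reaches-v)
    ... | _             | tri≈ _ u≡v _ = ⊥-elim (toℕ-≢ u≢v u≡v)
    ... | reaches-u , _ | tri> _ _ v<u = inj₂ (v<u , Equivalence.to (reach<⇔T _ v<u) reaches-u)

-- Cycles

cycleLane : ℕ → ℕ → ℕ
cycleLane n zero    = n ∸ 1
cycleLane n (suc k) = suc k

Wraps : ℕ → ℕ → ℕ → Set
Wraps n a b = (a ≡ 0 × suc b ≡ n) ⊎ (b ≡ 0 × suc a ≡ n)

Consecutive : ℕ → ℕ → Set
Consecutive a b = suc a ≡ b ⊎ suc b ≡ a

cycleLane-≡⇔ : ∀ n a b → a ≢ b → cycleLane n a ≡ cycleLane n b ⇔ Wraps n a b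
cycleLane-≡⇔ n a b a≢b = mk⇔ (to n a b a≢b) (from a b a≢b)
  where
  to : ∀ n a b → a ≢ b → cycleLane n a ≡ cycleLane n b → Wraps n a b
  to _       zero    zero    a≢b _  = ⊥-elim (a≢b refl)
  to (suc n) zero    (suc b) _   e  = inj₁ (refl , cong suc (sym e))
  to (suc n) (suc a) zero    _   e  = inj₂ (refl , cong suc e)
  to _       (suc a) (suc b) a≢b e  = ⊥-elim (a≢b e)
  to zero    zero    (suc b) _   ()
  to zero    (suc a) zero    _   ()
  from : ∀ a b → a ≢ b → Wraps n a b → cycleLane n a ≡ cycleLane n b
  from zero    zero    a≢b _                    = ⊥-elim (a≢b refl)
  from zero    (suc b) _   (inj₁ (_ , refl))    = refl
  from (suc a) zero    _   (inj₂ (_ , refl))    = refl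
  from (suc a) _       _   (inj₁ (() , _))
  from _       (suc b) _   (inj₂ (() , _))

within-one⇔ : ∀ {a b} → a ≢ b → (a ℕ.< suc (suc b) × b ℕ.< suc (suc a)) ⇔ Consecutive a b
within-one⇔ {a} {b} a≢b = mk⇔ to from
  where
  to : a ℕ.< suc (suc b) × b ℕ.< suc (suc a) → Consecutive a b
  to (a<2+b , b<2+a) with ℕP.<-cmp a b
  ... | tri< a<b _ _ = inj₁ (ℕP.≤-antisym a<b (ℕP.≤-pred b<2+a))
  ... | tri≈ _ a≡b _ = ⊥-elim (a≢b a≡b)
  ... | tri> _ _ b<a = inj₂ (ℕP.≤-antisym b<a (ℕP.≤-pred a<2+b))
  close : ∀ k → k ℕ.< suc (suc (suc k)) × suc k ℕ.< suc (suc k)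
  close k = ℕP.m<n+m k (s≤s z≤n) , ℕP.n<1+n (suc k)
  from : Consecutive a b → a ℕ.< suc (suc b) × b ℕ.< suc (suc a)
  from (inj₁ refl) = close a
  from (inj₂ refl) = proj₂ (close b) , proj₁ (close b)

¬consecutive∧wraps : ∀ {n a b} → 3 ℕ.≤ n → Consecutive a b → ¬ Wraps n a b
¬consecutive∧wraps (s≤s (s≤s (s≤s _))) (inj₁ refl) (inj₁ (refl , ()))
¬consecutive∧wraps (s≤s (s≤s (s≤s _))) (inj₂ refl) (inj₂ (refl , ()))
¬consecutive∧wraps _ (inj₁ refl) (inj₂ (() , _))
¬consecutive∧wraps _ (inj₂ refl) (inj₁ (() , _))

cycleModel : ∀ n → 3 ℕ.≤ n → IntervalModel (Fin n) (CycleAdj n)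
cycleModel n 3≤n = record { xs = xs ; ys = ys ; separated = separated ; adjacent⇔ = adjacent⇔ }
  where
  k<2+k : ∀ k → k ℕ.< suc (suc k)
  k<2+k k = s≤s (ℕP.n≤1+n k)
  xs ys : Fin n → Interval
  xs k = natInterval 0 (toℕ k) (suc (suc (toℕ k))) (k<2+k (toℕ k))
  ys k = unitAt (cycleLane n (toℕ k))
  x-overlap⇔ : ∀ u v → u ≢ v → Overlap (xs u) (xs v) ⇔ Consecutive (toℕ u) (toℕ v)
  x-overlap⇔ u v u≢v = ⇔.trans (natInterval-overlap⇔ (k<2+k (toℕ u)) (k<2+k (toℕ v)))
                                (⇔.trans (mk⇔ proj₂ (refl ,_)) (within-one⇔ (toℕ-≢ u≢v)))
  y-overlap⇔ : ∀ u v → u ≢ v → Overlap (ys u) (ys v) ⇔ Wraps n (toℕ u) (toℕ v)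
  y-overlap⇔ u v u≢v = ⇔.trans unitAt-overlap⇔ (cycleLane-≡⇔ n (toℕ u) (toℕ v) (toℕ-≢ u≢v))
  separated : ∀ u v → u ≢ v → Overlap (xs u) (xs v) → Overlap (ys u) (ys v) → ⊥
  separated u v u≢v x-overlap y-overlap =
    ¬consecutive∧wraps 3≤n (Equivalence.to (x-overlap⇔ u v u≢v) x-overlap)
                           (Equivalence.to (y-overlap⇔ u v u≢v) y-overlap)
  adjacent⇔ : ∀ u v → u ≢ v → CycleAdj n u v ⇔ (Overlap (ys u) (ys v) ⊎ Overlap (xs u) (xs v))
  adjacent⇔ u v u≢v =
    ⇔.trans (mk⇔ proj₂ (u≢v ,_))
      (⇔.trans rotate (⇔.sym (y-overlap⇔ u v u≢v ⊎-⇔ x-overlap⇔ u v u≢v)))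
    where
    rotate : ∀ {A B C : Set} → (A ⊎ B ⊎ C) ⇔ (C ⊎ (A ⊎ B))
    rotate = mk⇔ Sum.[ inj₂ ∘ inj₁ , Sum.[ inj₂ ∘ inj₂ , inj₁ ] ]
                 Sum.[ inj₂ ∘ inj₂ , Sum.[ inj₁ , inj₂ ∘ inj₁ ] ]

half : ℤ → ℤ
half (+ n)    = + ⌊ n /2⌋
half -[1+ n ] = -[1+ ⌊ n /2⌋ ]

half-double : ∀ k → half (k + k) ≡ k
half-double (+ n)    = cong +_ (sym (ℕP.n≡⌊n+n/2⌋ n))
half-double -[1+ n ] = cong -[1+_] (sym (ℕP.n≡⌈n+n/2⌉ n))

half-1+double : ∀ k → half (+ 1 + (k + k)) ≡ k
half-1+double (+ n)    = cong +_ (sym (ℕP.n≡⌈n+n/2⌉ n))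
half-1+double -[1+ n ] = cong -[1+_] (sym (ℕP.n≡⌊n+n/2⌋ n))

even-or-oddℕ : ∀ n → ∃[ k ] (n ≡ k ℕ.+ k ⊎ n ≡ suc (k ℕ.+ k))
even-or-oddℕ zero = 0 , inj₁ refl
even-or-oddℕ (suc n) with even-or-oddℕ n
... | k , inj₁ refl = k , inj₂ refl
... | k , inj₂ refl = suc k , inj₁ (cong suc (sym (ℕP.+-suc k k)))

even-or-odd : ∀ z → ∃[ k ] (z ≡ k + k ⊎ z ≡ + 1 + (k + k))
even-or-odd (+ n) with even-or-oddℕ n
... | k , inj₁ refl = + k , inj₁ refl
... | k , inj₂ refl = + k , inj₂ refl
even-or-odd -[1+ n ] with even-or-oddℕ n
... | k , inj₁ refl = -[1+ k ] , inj₂ refl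
... | k , inj₂ refl = -[1+ k ] , inj₁ refl

double+1 : ∀ k → k + k + + 1 ≡ + 1 + (k + k)
double+1 = solve-∀

1+double-1 : ∀ k → + 1 + (k + k) - + 1 ≡ k + k
1+double-1 = solve-∀

SameHalf : ℤ → ℤ → Set
SameHalf z d = d ≡ + 0 ⊎ (d ≡ + 1 × IsEven z) ⊎ (d ≡ - + 1 × IsEven (z - + 1))

half-≡⇔ : ∀ z d → half z ≡ half (z + d) ⇔ SameHalf z d
half-≡⇔ z d = mk⇔ to from
  where
  half-of : ∀ {z k} → z ≡ k + k ⊎ z ≡ + 1 + (k + k) → half z ≡ k
  half-of {k = k} (inj₁ refl) = half-double k
  half-of {k = k} (inj₂ refl) = half-1+double k
  one : ∀ k → + 1 + (k + k) - (k + k) ≡ + 1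
  one = solve-∀
  minus-one : ∀ k → k + k - (+ 1 + (k + k)) ≡ - + 1
  minus-one = solve-∀
  to : half z ≡ half (z + d) → SameHalf z d
  to eq with even-or-odd z | even-or-odd (z + d)
  ... | k , pz | k' , pz' with trans (sym (half-of {z} {k} pz)) (trans eq (half-of {z + d} {k'} pz'))
  to eq | k , inj₁ e | .k , inj₁ e' | refl = inj₁ (trans (offset≡ e e') (ℤP.+-inverseʳ (k + k)))
  to eq | k , inj₁ e | .k , inj₂ e' | refl = inj₂ (inj₁ (trans (offset≡ e e') (one k) , k , e))
  to eq | k , inj₂ e | .k , inj₁ e' | refl =
    inj₂ (inj₂ (trans (offset≡ e e') (minus-one k) , k , trans (cong (_- + 1) e) (1+double-1 k)))
  to eq | k , inj₂ e | .k , inj₂ e' | refl =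
    inj₁ (trans (offset≡ e e') (ℤP.+-inverseʳ (+ 1 + (k + k))))
  from : SameHalf z d → half z ≡ half (z + d)
  from (inj₁ refl) = cong half (sym (ℤP.+-identityʳ z))
  from (inj₂ (inj₁ (refl , k , e))) =
    trans (half-of {k = k} (inj₁ e))
          (sym (half-of {k = k} (inj₂ (trans (cong (_+ + 1) e) (double+1 k)))))
  from (inj₂ (inj₂ (refl , k , e))) =
    trans (half-of {k = k} (inj₂ (trans (restore z) (cong (λ x → + 1 + x) e))))
          (sym (half-of {k = k} (inj₁ e)))
    where
    restore : ∀ z → z ≡ + 1 + (z - + 1)
    restore = solve-∀

isEven⊎isOdd : ∀ z → IsEven z ⊎ IsEven (z - + 1)
isEven⊎isOdd z with even-or-odd z
... | k , inj₁ e = inj₁ (k , e)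
... | k , inj₂ e = inj₂ (k , trans (cong (_- + 1) e) (1+double-1 k))

isOdd⇒isEven-suc : ∀ {z} → IsEven (z - + 1) → IsEven (z + + 1)
isOdd⇒isEven-suc {z} (k , e) = k + + 1 , trans (shift z) (trans (cong (_+ + 2) e) (regroup k))
  where
  shift : ∀ z → z + + 1 ≡ z - + 1 + + 2
  shift = solve-∀
  regroup : ∀ k → k + k + + 2 ≡ k + + 1 + (k + + 1)
  regroup = solve-∀

¬even∧even-suc : ∀ {z} → IsEven z → ¬ IsEven (z + + 1)
¬even∧even-suc (k , refl) (k' , e) =
  ℤP.i≢suc[i] (sym (subst (λ m → + 1 + (k + k) ≡ m + m) (sym k≡k') odd))
  where
  odd : + 1 + (k + k) ≡ k' + k'
  odd = trans (sym (double+1 k)) e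
  k≡k' : k ≡ k'
  k≡k' = trans (sym (half-1+double k)) (trans (cong half odd) (half-double k'))

-- Lattices

0² : ℤ²
0² = (+ 0 , + 0)

_⊕_ : ℤ² → ℤ² → ℤ²
(i , j) ⊕ (α , β) = (i + α , j + β)

⊕-identityʳ : ∀ u → u ⊕ 0² ≡ u
⊕-identityʳ (i , j) = cong₂ _,_ (ℤP.+-identityʳ i) (ℤP.+-identityʳ j)

diff-⊕ : ∀ u d → diff u (u ⊕ d) ≡ d
diff-⊕ (i , j) (α , β) = cong₂ _,_ (cancel i α) (cancel j β)
  where
  cancel : ∀ a b → a + b - a ≡ b
  cancel = solve-∀

data Offset (u : ℤ²) : ℤ² → Set where
  offset : ∀ d → Offset u (u ⊕ d)

offset-view : ∀ u v → Offset u v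
offset-view u@(i , j) v@(i' , j') =
  subst (Offset u) (cong₂ _,_ (cancel i i') (cancel j j')) (offset (diff u v))
  where
  cancel : ∀ a b → a + (b - a) ≡ b
  cancel = solve-∀

offsetModel : ∀ {Adj : ℤ² → ℤ² → Set} (xs ys : ℤ² → Interval) →
  (∀ u d → d ≢ 0² → Overlap (xs u) (xs (u ⊕ d)) → Overlap (ys u) (ys (u ⊕ d)) → ⊥) →
  (∀ u d → d ≢ 0² → Adj u (u ⊕ d) ⇔ (Overlap (ys u) (ys (u ⊕ d)) ⊎ Overlap (xs u) (xs (u ⊕ d)))) →
  IntervalModel ℤ² Adj
offsetModel {Adj} xs ys separated-offset adjacent-offset⇔ = record
  { xs = xs ; ys = ys ; separated = separated ; adjacent⇔ = adjacent⇔ }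
  where
  nonzero : ∀ {u} d → u ≢ u ⊕ d → d ≢ 0²
  nonzero {u} d u≢u⊕d refl = u≢u⊕d (sym (⊕-identityʳ u))
  separated : ∀ u v → u ≢ v → Overlap (xs u) (xs v) → Overlap (ys u) (ys v) → ⊥
  separated u v u≢v with offset-view u v
  ... | offset d = separated-offset u d (nonzero d u≢v)
  adjacent⇔ : ∀ u v → u ≢ v → Adj u v ⇔ (Overlap (ys u) (ys v) ⊎ Overlap (xs u) (xs v))
  adjacent⇔ u v u≢v with offset-view u v
  ... | offset d = adjacent-offset⇔ u d (nonzero d u≢v)

∣∣<2⇒unit : ∀ a → ∣ a ∣ ℕ.< 2 → a ≢ + 0 → a ≡ + 1 ⊎ a ≡ - + 1
∣∣<2⇒unit (+ zero)        _                     a≢0 = ⊥-elim (a≢0 refl)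
∣∣<2⇒unit (+ suc zero)    _                     _   = inj₁ refl
∣∣<2⇒unit (+ suc (suc n)) (s≤s (s≤s ()))        _
∣∣<2⇒unit -[1+ zero ]     _                     _   = inj₂ refl
∣∣<2⇒unit -[1+ suc n ]    (s≤s (s≤s ()))        _

∣-offset∣ : ∀ i α → ∣ i - (i + α) ∣ ≡ ∣ α ∣
∣-offset∣ i α = trans (cong ∣_∣ (negate i α)) (ℤP.∣-i∣≡∣i∣ α)
  where
  negate : ∀ i α → i - (i + α) ≡ - α
  negate = solve-∀

+≡1 : ∀ m n → m ℕ.+ n ≡ 1 → (m ≡ 0 × n ≡ 1) ⊎ (m ≡ 1 × n ≡ 0)
+≡1 zero          (suc zero) refl = inj₁ (refl , refl)
+≡1 (suc zero)    zero       refl = inj₂ (refl , refl)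
+≡1 zero          zero             ()
+≡1 zero          (suc (suc n))    ()
+≡1 (suc zero)    (suc n)          ()
+≡1 (suc (suc m)) n                ()

gridAdj-offset⇔ : ∀ u α β → GridAdj u (u ⊕ (α , β)) ⇔ (∣ α ∣ ℕ.+ ∣ β ∣ ≡ 1)
gridAdj-offset⇔ (i , j) α β rewrite ∣-offset∣ i α | ∣-offset∣ j β = ⇔.refl

grid-step⇔ : ∀ α β → (α , β) ≢ 0² →
             (∣ α ∣ ℕ.+ ∣ β ∣ ≡ 1) ⇔ ((α ≡ + 0 × ∣ β ∣ ℕ.< 2) ⊎ (β ≡ + 0 × ∣ α ∣ ℕ.< 2))
grid-step⇔ α β d≢0 = mk⇔ to from
  where
  <2 : ∀ {n} → n ≡ 1 → n ℕ.< 2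
  <2 refl = s≤s (s≤s z≤n)
  to : ∣ α ∣ ℕ.+ ∣ β ∣ ≡ 1 → (α ≡ + 0 × ∣ β ∣ ℕ.< 2) ⊎ (β ≡ + 0 × ∣ α ∣ ℕ.< 2)
  to sum≡1 with +≡1 ∣ α ∣ ∣ β ∣ sum≡1
  ... | inj₁ (∣α∣≡0 , ∣β∣≡1) = inj₁ (ℤP.∣i∣≡0⇒i≡0 ∣α∣≡0 , <2 ∣β∣≡1)
  ... | inj₂ (∣α∣≡1 , ∣β∣≡0) = inj₂ (ℤP.∣i∣≡0⇒i≡0 ∣β∣≡0 , <2 ∣α∣≡1)
  from : (α ≡ + 0 × ∣ β ∣ ℕ.< 2) ⊎ (β ≡ + 0 × ∣ α ∣ ℕ.< 2) → ∣ α ∣ ℕ.+ ∣ β ∣ ≡ 1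
  from (inj₁ (refl , ∣β∣<2)) with ∣∣<2⇒unit β ∣β∣<2 (λ { refl → d≢0 refl })
  ... | inj₁ refl = refl
  ... | inj₂ refl = refl
  from (inj₂ (refl , ∣α∣<2)) with ∣∣<2⇒unit α ∣α∣<2 (λ { refl → d≢0 refl })
  ... | inj₁ refl = refl
  ... | inj₂ refl = refl

gridX gridY : ℤ² → Interval
gridX (i , j) = slot j i 2
gridY (i , j) = slot i j 2

gridModel : IntervalModel ℤ² GridAdj
gridModel = offsetModel gridX gridY separated adjacent⇔
  where
  separated : ∀ u d → d ≢ 0² →
              Overlap (gridX u) (gridX (u ⊕ d)) → Overlap (gridY u) (gridY (u ⊕ d)) → ⊥
  separated (i , j) (α , β) d≢0 x-overlap y-overlap
    with Equivalence.to (shifted-slot-overlap⇔ j β i α 2) x-overlap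
       | Equivalence.to (shifted-slot-overlap⇔ i α j β 2) y-overlap
  ... | refl , _ | refl , _ = d≢0 refl
  adjacent⇔ : ∀ u d → d ≢ 0² →
              GridAdj u (u ⊕ d) ⇔ (Overlap (gridY u) (gridY (u ⊕ d)) ⊎ Overlap (gridX u) (gridX (u ⊕ d)))
  adjacent⇔ (i , j) (α , β) d≢0 =
    ⇔.trans (gridAdj-offset⇔ (i , j) α β)
      (⇔.trans (grid-step⇔ α β d≢0)
        (⇔.sym (shifted-slot-overlap⇔ i α j β 2 ⊎-⇔ shifted-slot-overlap⇔ j β i α 2)))

HexStep : ℤ → ℤ² → Set
HexStep z d = (d ≡ (+ 1 , + 0)) ⊎ (d ≡ (- + 1 , + 0))
            ⊎ ((d ≡ (+ 0 , + 1)) × IsEven z) ⊎ ((d ≡ (+ 0 , - + 1)) × IsEven (z - + 1))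

hexAdj-offset⇔ : ∀ i j d → HexAdj (i , j) ((i , j) ⊕ d) ⇔ HexStep (i + j) d
hexAdj-offset⇔ i j d rewrite diff-⊕ (i , j) d = ⇔.refl

hex-step⇔ : ∀ z α β → (α , β) ≢ 0² →
            HexStep z (α , β) ⇔ ((α ≡ + 0 × SameHalf z β) ⊎ (β ≡ + 0 × ∣ α ∣ ℕ.< 2))
hex-step⇔ z α β d≢0 = mk⇔ to from
  where
  to : HexStep z (α , β) → (α ≡ + 0 × SameHalf z β) ⊎ (β ≡ + 0 × ∣ α ∣ ℕ.< 2)
  to (inj₁ refl)                       = inj₂ (refl , s≤s (s≤s z≤n))
  to (inj₂ (inj₁ refl))                = inj₂ (refl , s≤s (s≤s z≤n))
  to (inj₂ (inj₂ (inj₁ (refl , even)))) = inj₁ (refl , inj₂ (inj₁ (refl , even)))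
  to (inj₂ (inj₂ (inj₂ (refl , even)))) = inj₁ (refl , inj₂ (inj₂ (refl , even)))
  from : (α ≡ + 0 × SameHalf z β) ⊎ (β ≡ + 0 × ∣ α ∣ ℕ.< 2) → HexStep z (α , β)
  from (inj₁ (refl , inj₁ refl))                = ⊥-elim (d≢0 refl)
  from (inj₁ (refl , inj₂ (inj₁ (refl , even)))) = inj₂ (inj₂ (inj₁ (refl , even)))
  from (inj₁ (refl , inj₂ (inj₂ (refl , even)))) = inj₂ (inj₂ (inj₂ (refl , even)))
  from (inj₂ (refl , ∣α∣<2)) with ∣∣<2⇒unit α ∣α∣<2 (λ { refl → d≢0 refl })
  ... | inj₁ refl = inj₁ refl
  ... | inj₂ refl = inj₂ (inj₁ refl)

-- (i , j) and (i , j + 1) with i + j even share the position half (i + j) on column lane i.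
hexY : ℤ² → Interval
hexY (i , j) = slot i (half (i + j)) 1

hexY-overlap⇔ : ∀ i j α β →
                Overlap (hexY (i , j)) (hexY (i + α , j + β)) ⇔ (α ≡ + 0 × SameHalf (i + j) β)
hexY-overlap⇔ i j α β =
  ⇔.trans (slot-overlap⇔ i (i + α) (half (i + j)) (half (i + α + (j + β))) 1) (mk⇔ to from)
  where
  regroup : ∀ i j β → i + + 0 + (j + β) ≡ i + j + β
  regroup = solve-∀
  to : i ≡ i + α × ∣ half (i + α + (j + β)) - half (i + j) ∣ ℕ.< 1 → α ≡ + 0 × SameHalf (i + j) β
  to (same-lane , close) with Equivalence.to (≡+⇔≡0 i α) same-lane
  ... | refl = refl , Equivalence.to (half-≡⇔ (i + j) β)
                        (trans (Equivalence.to (∣-∣<1⇔≡ _ _) close) (cong half (regroup i j β)))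
  from : α ≡ + 0 × SameHalf (i + j) β → i ≡ i + α × ∣ half (i + α + (j + β)) - half (i + j) ∣ ℕ.< 1
  from (refl , same) = Equivalence.from (≡+⇔≡0 i (+ 0)) refl
                     , Equivalence.from (∣-∣<1⇔≡ _ _)
                         (trans (Equivalence.from (half-≡⇔ (i + j) β) same) (cong half (sym (regroup i j β))))

hexModel : IntervalModel ℤ² HexAdj
hexModel = offsetModel gridX hexY separated adjacent⇔
  where
  separated : ∀ u d → d ≢ 0² → Overlap (gridX u) (gridX (u ⊕ d)) → Overlap (hexY u) (hexY (u ⊕ d)) → ⊥
  separated (i , j) (α , β) d≢0 x-overlap y-overlap
    with Equivalence.to (shifted-slot-overlap⇔ j β i α 2) x-overlap
       | Equivalence.to (hexY-overlap⇔ i j α β) y-overlap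
  ... | refl , _ | refl , _ = d≢0 refl
  adjacent⇔ : ∀ u d → d ≢ 0² →
              HexAdj u (u ⊕ d) ⇔ (Overlap (hexY u) (hexY (u ⊕ d)) ⊎ Overlap (gridX u) (gridX (u ⊕ d)))
  adjacent⇔ (i , j) (α , β) d≢0 =
    ⇔.trans (hexAdj-offset⇔ i j (α , β))
      (⇔.trans (hex-step⇔ (i + j) α β d≢0)
        (⇔.sym (hexY-overlap⇔ i j α β ⊎-⇔ shifted-slot-overlap⇔ j β i α 2)))

∣2α∣<3 : ∀ α → ∣ α * + 2 + + 0 ∣ ℕ.< 3 → α ≢ + 0 → α ≡ + 1 ⊎ α ≡ - + 1
∣2α∣<3 (+ zero) _ α≢0 = ⊥-elim (α≢0 refl)
∣2α∣<3 (+ suc zero) _ _ = inj₁ refl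
∣2α∣<3 -[1+ zero ] _ _ = inj₂ refl
∣2α∣<3 (+ suc (suc n)) (s≤s (s≤s (s≤s ()))) _
∣2α∣<3 -[1+ suc n ] (s≤s (s≤s (s≤s ()))) _

∣2α∣<2 : ∀ α → ∣ α * + 2 + + 0 ∣ ℕ.< 2 → α ≡ + 0
∣2α∣<2 (+ zero) _ = refl
∣2α∣<2 (+ suc n) (s≤s (s≤s ()))
∣2α∣<2 -[1+ n ] (s≤s (s≤s ()))

∣2α+1∣<3 : ∀ α → ∣ α * + 2 + + 1 ∣ ℕ.< 3 → α ≡ + 0 ⊎ α ≡ - + 1
∣2α+1∣<3 (+ zero) _ = inj₁ refl
∣2α+1∣<3 -[1+ zero ] _ = inj₂ refl
∣2α+1∣<3 (+ suc zero) (s≤s (s≤s (s≤s ())))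
∣2α+1∣<3 (+ suc (suc n)) (s≤s (s≤s (s≤s ())))
∣2α+1∣<3 -[1+ suc n ] (s≤s (s≤s (s≤s ())))

∣2α-1∣<3 : ∀ α → ∣ α * + 2 + - + 1 ∣ ℕ.< 3 → α ≡ + 0 ⊎ α ≡ + 1
∣2α-1∣<3 (+ zero) _ = inj₁ refl
∣2α-1∣<3 (+ suc zero) _ = inj₂ refl
∣2α-1∣<3 (+ suc (suc n)) (s≤s (s≤s (s≤s ())))
∣2α-1∣<3 -[1+ n ] (s≤s (s≤s (s≤s ())))

TriStep : ℤ² → Set
TriStep d = (d ≡ (+ 1 , + 0)) ⊎ (d ≡ (- + 1 , + 0)) ⊎ (d ≡ (+ 0 , - + 1))
          ⊎ (d ≡ (+ 1 , - + 1)) ⊎ (d ≡ (- + 1 , + 1)) ⊎ (d ≡ (+ 0 , + 1))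

triAdj-offset⇔ : ∀ u d → TriAdj u (u ⊕ d) ⇔ TriStep d
triAdj-offset⇔ u d rewrite diff-⊕ u d = ⇔.refl

TriX TriY : ℤ → ℤ → ℤ → Set
TriX j α β = SameHalf j β × ∣ α * + 2 + β ∣ ℕ.< 3
TriY j α β = SameHalf (j + + 1) β × ∣ α * + 2 + β ∣ ℕ.< 2

-- Rows 2k and 2k + 1 share a lane of triX, rows 2k - 1 and 2k one of triY; on a shared lane
-- the position 2i + j is within the interval width exactly for the neighbours.
triX triY : ℤ² → Interval
triX (i , j) = slot (half j) (i * + 2 + j) 3
triY (i , j) = slot (half (j + + 1)) (i * + 2 + j) 2

position-offset : ∀ i j α β → (i + α) * + 2 + (j + β) - (i * + 2 + j) ≡ α * + 2 + β
position-offset = solve-∀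

triX-overlap⇔ : ∀ i j α β → Overlap (triX (i , j)) (triX (i + α , j + β)) ⇔ TriX j α β
triX-overlap⇔ i j α β =
  ⇔.trans (slot-overlap⇔ (half j) (half (j + β)) (i * + 2 + j) ((i + α) * + 2 + (j + β)) 3)
          (half-≡⇔ j β ×-⇔ subst-⇔ (λ x → ∣ x ∣ ℕ.< 3) (position-offset i j α β))

triY-overlap⇔ : ∀ i j α β → Overlap (triY (i , j)) (triY (i + α , j + β)) ⇔ TriY j α β
triY-overlap⇔ i j α β =
  ⇔.trans (slot-overlap⇔ (half (j + + 1)) (half (j + β + + 1)) (i * + 2 + j) ((i + α) * + 2 + (j + β)) 2)
          (⇔.trans (subst-⇔ (λ x → half (j + + 1) ≡ half x) (swap j β)) (half-≡⇔ (j + + 1) β)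
           ×-⇔ subst-⇔ (λ x → ∣ x ∣ ℕ.< 2) (position-offset i j α β))
  where
  swap : ∀ j β → j + β + + 1 ≡ j + + 1 + β
  swap = solve-∀

tri-vertical : ∀ j α β → ∣ α * + 2 + β ∣ ℕ.< 2 → β ≡ + 1 ⊎ β ≡ - + 1 → TriY j α β ⊎ TriX j α β
tri-vertical j α β close β≡±1 with isEven⊎isOdd j | β≡±1
... | inj₁ even | inj₁ refl = inj₂ (inj₂ (inj₁ (refl , even)) , ℕP.m<n⇒m<1+n close)
... | inj₁ even | inj₂ refl = inj₁ (inj₂ (inj₂ (refl , subst IsEven (sym (+1-1 j)) even)) , close)
  where
  +1-1 : ∀ j → j + + 1 - + 1 ≡ j
  +1-1 = solve-∀
... | inj₂ odd  | inj₁ refl = inj₁ (inj₂ (inj₁ (refl , isOdd⇒isEven-suc {j} odd)) , close)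
... | inj₂ odd  | inj₂ refl = inj₂ (inj₂ (inj₂ (refl , odd)) , ℕP.m<n⇒m<1+n close)

tri-step-of : ∀ α β → β ≡ + 0 ⊎ β ≡ + 1 ⊎ β ≡ - + 1 → ∣ α * + 2 + β ∣ ℕ.< 3 → (α , β) ≢ 0² →
              TriStep (α , β)
tri-step-of α β (inj₁ refl) close d≢0 with ∣2α∣<3 α close (λ { refl → d≢0 refl })
... | inj₁ refl = inj₁ refl
... | inj₂ refl = inj₂ (inj₁ refl)
tri-step-of α β (inj₂ (inj₁ refl)) close _ with ∣2α+1∣<3 α close
... | inj₁ refl = inj₂ (inj₂ (inj₂ (inj₂ (inj₂ refl))))
... | inj₂ refl = inj₂ (inj₂ (inj₂ (inj₂ (inj₁ refl))))
tri-step-of α β (inj₂ (inj₂ refl)) close _ with ∣2α-1∣<3 α close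
... | inj₁ refl = inj₂ (inj₂ (inj₁ refl))
... | inj₂ refl = inj₂ (inj₂ (inj₂ (inj₁ refl)))

sameHalf-offset : ∀ {z d} → SameHalf z d → d ≡ + 0 ⊎ d ≡ + 1 ⊎ d ≡ - + 1
sameHalf-offset = Sum.map₂ (Sum.map proj₁ proj₁)

tri-step⇔ : ∀ j α β → (α , β) ≢ 0² → TriStep (α , β) ⇔ (TriY j α β ⊎ TriX j α β)
tri-step⇔ j α β d≢0 = mk⇔ to from
  where
  two<3 : 2 ℕ.< 3
  two<3 = ℕP.n<1+n 2
  one<2 : 1 ℕ.< 2
  one<2 = ℕP.n<1+n 1
  to : TriStep (α , β) → TriY j α β ⊎ TriX j α β
  to (inj₁ refl)                                       = inj₂ (inj₁ refl , two<3)
  to (inj₂ (inj₁ refl))                                = inj₂ (inj₁ refl , two<3)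
  to (inj₂ (inj₂ (inj₁ refl)))                         = tri-vertical j α β one<2 (inj₂ refl)
  to (inj₂ (inj₂ (inj₂ (inj₁ refl))))                  = tri-vertical j α β one<2 (inj₂ refl)
  to (inj₂ (inj₂ (inj₂ (inj₂ (inj₁ refl)))))           = tri-vertical j α β one<2 (inj₁ refl)
  to (inj₂ (inj₂ (inj₂ (inj₂ (inj₂ refl)))))           = tri-vertical j α β one<2 (inj₁ refl)
  from : TriY j α β ⊎ TriX j α β → TriStep (α , β)
  from (inj₁ (same , close)) = tri-step-of α β (sameHalf-offset same) (ℕP.m<n⇒m<1+n close) d≢0
  from (inj₂ (same , close)) = tri-step-of α β (sameHalf-offset same) close d≢0

tri-separated : ∀ j α β → (α , β) ≢ 0² → TriX j α β → TriY j α β → ⊥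
tri-separated j α β d≢0 (inj₁ refl , _) (_ , close) with ∣2α∣<2 α close
... | refl = d≢0 refl
tri-separated j α β _ (inj₂ (inj₁ (refl , even)) , _) (inj₂ (inj₁ (_ , even')) , _) = ¬even∧even-suc even even'
tri-separated j α β _ (inj₂ (inj₂ (refl , odd)) , _) (inj₂ (inj₂ (_ , odd')) , _) =
  ¬even∧even-suc odd (subst IsEven (shift j) odd')
  where
  shift : ∀ j → j + + 1 - + 1 ≡ j - + 1 + + 1
  shift = solve-∀
tri-separated j α β _ (inj₂ (inj₁ (refl , _)) , _) (inj₁ () , _)
tri-separated j α β _ (inj₂ (inj₁ (refl , _)) , _) (inj₂ (inj₂ (() , _)) , _)
tri-separated j α β _ (inj₂ (inj₂ (refl , _)) , _) (inj₁ () , _)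
tri-separated j α β _ (inj₂ (inj₂ (refl , _)) , _) (inj₂ (inj₁ (() , _)) , _)

triModel : IntervalModel ℤ² TriAdj
triModel = offsetModel triX triY separated adjacent⇔
  where
  separated : ∀ u d → d ≢ 0² → Overlap (triX u) (triX (u ⊕ d)) → Overlap (triY u) (triY (u ⊕ d)) → ⊥
  separated (i , j) (α , β) d≢0 x-overlap y-overlap =
    tri-separated j α β d≢0 (Equivalence.to (triX-overlap⇔ i j α β) x-overlap)
                            (Equivalence.to (triY-overlap⇔ i j α β) y-overlap)
  adjacent⇔ : ∀ u d → d ≢ 0² →
              TriAdj u (u ⊕ d) ⇔ (Overlap (triY u) (triY (u ⊕ d)) ⊎ Overlap (triX u) (triX (u ⊕ d)))
  adjacent⇔ (i , j) (α , β) d≢0 =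
    ⇔.trans (triAdj-offset⇔ (i , j) (α , β))
      (⇔.trans (tri-step⇔ j α β d≢0)
        (⇔.sym (triY-overlap⇔ i j α β ⊎-⇔ triX-overlap⇔ i j α β)))

-- Trees

module SimplePaths (G : Graph) (_≟_ : DecidableEquality (Graph.V G)) where

  open Graph G renaming (sym to adj-sym)
  open import Data.List.Membership.DecPropositional _≟_ using (_∈?_)

  record SimplePath (u w : V) : Set where
    constructor simplePath
    field
      steps  : List V
      unique : Unique (u ∷ steps)
      chain  : Chain G u steps
      ends   : lastOf G u steps ≡ w

  open SimplePath

  lastOf-∈ : ∀ x L → lastOf G x L ∈ x ∷ L
  lastOf-∈ x []      = here refl
  lastOf-∈ x (y ∷ L) = there (lastOf-∈ y L)

  lastOf-++ : ∀ x P Q → lastOf G x (P ++ Q) ≡ lastOf G (lastOf G x P) Q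
  lastOf-++ x []      Q = refl
  lastOf-++ x (y ∷ P) Q = lastOf-++ y P Q

  chain-++ : ∀ x P Q → Chain G x P → Chain G (lastOf G x P) Q → Chain G x (P ++ Q)
  chain-++ x []      Q _               c = c
  chain-++ x (y ∷ P) Q (x~y , chainP) c = x~y , chain-++ y P Q chainP c

  unique-++⁻ˡ : ∀ (P Q : List V) → Unique (P ++ Q) → Unique P
  unique-++⁻ˡ []      Q _              = []
  unique-++⁻ˡ (x ∷ P) Q (x∉PQ ∷ uniq) = ++⁻ˡ P x∉PQ ∷ unique-++⁻ˡ P Q uniq

  suffix : ∀ {u x w} (P : SimplePath x w) → u ∈ x ∷ steps P → SimplePath u w
  suffix P (here refl) = P
  suffix (simplePath (y ∷ L) (_ ∷ unique) (_ , chain) ends) (there u∈) =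
    suffix (simplePath L unique chain ends) u∈

  -- Loop erasure: whenever the walk revisits a vertex, the loop in between is cut out.
  walk⇒simplePath : ∀ {u w} → Walk G u w → SimplePath u w
  walk⇒simplePath here = simplePath [] ([] ∷ []) tt refl
  walk⇒simplePath {u} (step {w = x} u~x W) with walk⇒simplePath W
  ... | P with u ∈? x ∷ steps P
  ...   | yes u∈ = suffix P u∈
  ...   | no u∉  = simplePath (x ∷ steps P) (¬Any⇒All¬ _ u∉ ∷ unique P) (u~x , chain P) (ends P)

  prefix : ∀ {x m} As → Chain G x As → m ∈ x ∷ As →
           ∃[ P ] ∃[ S ] (As ≡ P ++ S × Chain G x P × lastOf G x P ≡ m)
  prefix As        _                (here refl) = [] , As , refl , tt , refl
  prefix (y ∷ As) (x~y , chain) (there m∈) with prefix As chain m∈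
  ... | P , S , refl , chainP , lastP = y ∷ P , S , refl , (x~y , chainP) , lastP

  StartsWith : V → List V → Set
  StartsWith y []      = ⊥
  StartsWith y (z ∷ _) = z ≡ y

  closed-chain⇒cycle : ∀ x L → 2 ℕ.≤ length L → Unique (x ∷ L) → Chain G x L → Adj (lastOf G x L) x →
                       HasCycle G
  closed-chain⇒cycle x (a ∷ b ∷ L) _               unique chain closing = x , a , b , L , unique , chain , closing
  closed-chain⇒cycle x (a ∷ [])    (s≤s ()) _      _     _

  -- Walk along B until it first meets A; A up to there, B back to y, and the edge y x close a cycle.
  module _ {x y z} (x~y : Adj x y) (A : SimplePath x z) (B : SimplePath y z)
           (A↛y : ¬ StartsWith y (steps A)) (B↛x : ¬ StartsWith x (steps B)) where

    long-enough : ∀ {cur R} P S acc → acc ʳ++ (cur ∷ R) ≡ y ∷ steps B → steps A ≡ P ++ S →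
                  lastOf G x P ≡ cur → 2 ℕ.≤ length (P ++ acc)
    long-enough (_ ∷ _ ∷ _) _ _           _     _   _    = s≤s (s≤s z≤n)
    long-enough (_ ∷ [])    _ (_ ∷ _)     _     _   _    = s≤s (s≤s z≤n)
    long-enough []          _ (_ ∷ _ ∷ _) _     _   _    = s≤s (s≤s z≤n)
    long-enough []          _ []          split _   refl = ⊥-elim (irrefl (subst (Adj x) (sym (∷-injectiveˡ split)) x~y))
    long-enough []          _ (_ ∷ [])    split _   refl = ⊥-elim (B↛x (subst (StartsWith x) (∷-injectiveʳ split) refl))
    long-enough (p ∷ [])    _ []          split A≡  refl =
      ⊥-elim (A↛y (subst (StartsWith y) (sym A≡) (∷-injectiveˡ split)))

    close : ∀ {cur} (Back : SimplePath cur y) P S → steps A ≡ P ++ S → Chain G x P → lastOf G x P ≡ cur →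
            All (_∉ x ∷ steps A) (steps Back) → 2 ℕ.≤ length (P ++ steps Back) → HasCycle G
    close {cur} Back P S A≡ chainP lastP fresh-A long =
      closed-chain⇒cycle x (P ++ acc) long
        (Unique.++⁺ {xs = x ∷ P} uniqueP uniqueAcc disjoint)
        (chain-++ x P acc chainP (subst (λ w → Chain G w acc) (sym lastP) (chain Back)))
        (subst (λ w → Adj w x) (sym lastPacc) (adj-sym x~y))
      where
      acc : List V
      acc = steps Back
      uniqueP : Unique (x ∷ P)
      uniqueP = unique-++⁻ˡ (x ∷ P) S (subst (λ L → Unique (x ∷ L)) A≡ (unique A))
      uniqueAcc : Unique acc
      uniqueAcc with unique Back
      ... | _ ∷ u = u
      disjoint : ∀ {v} → v ∈ x ∷ P × v ∈ acc → ⊥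
      disjoint (v∈P , v∈acc) = All.lookup fresh-A v∈acc (subst (λ L → _ ∈ x ∷ L) (sym A≡) (∈-++⁺ˡ v∈P))
      lastPacc : lastOf G x (P ++ acc) ≡ y
      lastPacc = trans (lastOf-++ x P acc) (trans (cong (λ w → lastOf G w acc) lastP) (ends Back))

    walk : ∀ {cur} (Rest : SimplePath cur z) (Back : SimplePath cur y) →
           All (_∉ steps Rest) (steps Back) → All (_∉ x ∷ steps A) (steps Back) →
           steps Back ʳ++ (cur ∷ steps Rest) ≡ y ∷ steps B → HasCycle G
    walk {cur} Rest Back fresh-B fresh-A split with cur ∈? x ∷ steps A
    ... | yes cur∈A with prefix (steps A) (chain A) cur∈A
    ...   | P , S , A≡ , chainP , lastP =
      close Back P S A≡ chainP lastP fresh-A (long-enough P S (steps Back) split A≡ lastP)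
    walk {cur} (simplePath [] _ _ cur≡z) Back _ _ _ | no cur∉A =
      ⊥-elim (cur∉A (subst (_∈ x ∷ steps A) (trans (ends A) (sym cur≡z)) (lastOf-∈ x (steps A))))
    walk {cur} (simplePath (c ∷ R) (cur∉cR ∷ uniqueR) (cur~c , chainR) endsR)
               (simplePath acc uniqueAcc chainAcc endsAcc) fresh-B fresh-A split | no cur∉A =
      walk (simplePath R uniqueR chainR endsR)
           (simplePath (cur ∷ acc) (c∉ ∷ uniqueAcc) (adj-sym cur~c , chainAcc) endsAcc)
           (All¬⇒¬Any (All.tail cur∉cR) ∷ All.map (λ a∉cR → a∉cR ∘ there) fresh-B)
           (cur∉A ∷ fresh-A)
           split
      where
      c∉ : All (c ≢_) (cur ∷ acc)
      c∉ = (λ c≡cur → All.head cur∉cR (sym c≡cur)) ∷ All.map (λ a∉cR c≡a → a∉cR (here (sym c≡a))) fresh-B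

    adjacent-paths⇒cycle : HasCycle G
    adjacent-paths⇒cycle = walk B (simplePath [] ([] ∷ []) tt refl) [] [] refl

record Rooting (G : Graph) : Set where
  open Graph G
  field
    root         : V
    parent       : V → V
    depth        : V → ℕ
    parent-root  : parent root ≡ root
    parent-adj   : ∀ v → v ≢ root → Adj v (parent v)
    depth-parent : ∀ v → v ≢ root → depth v ≡ suc (depth (parent v))
    edge-parent  : ∀ u v → Adj u v → parent u ≡ v ⊎ parent v ≡ u

module _ (G : Graph) (_≟_ : DecidableEquality (Graph.V G)) (acyclic : Acyclic G) where

  open Graph G renaming (sym to adj-sym)
  open SimplePaths G _≟_
  open SimplePath

  chains-unique : ∀ x L M → Unique (x ∷ L) → Chain G x L → Unique (x ∷ M) → Chain G x M →
                  lastOf G x L ≡ lastOf G x M → L ≡ M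
  chains-unique x []      []      _ _ _ _ _ = refl
  chains-unique x []      (b ∷ M) _ _ (x∉bM ∷ _) _ x≡last = ⊥-elim (All.lookup x∉bM (lastOf-∈ b M) x≡last)
  chains-unique x (a ∷ L) []      (x∉aL ∷ _) _ _ _ last≡x = ⊥-elim (All.lookup x∉aL (lastOf-∈ a L) (sym last≡x))
  chains-unique x (a ∷ L) (b ∷ M) (x∉aL ∷ uniqueL) (x~a , chainL) (x∉bM ∷ uniqueM) (x~b , chainM) same-end
    with a ≟ b
  ... | yes refl = cong (a ∷_) (chains-unique a L M uniqueL chainL uniqueM chainM same-end)
  ... | no a≢b = ⊥-elim (acyclic (adjacent-paths⇒cycle (adj-sym x~a)
                   (simplePath L uniqueL chainL same-end) (simplePath (b ∷ M) (x∉bM ∷ uniqueM) (x~b , chainM) refl)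
                   (L↛x L (All.tail x∉aL)) (λ b≡a → a≢b (sym b≡a))))
    where
    L↛x : ∀ L → All (x ≢_) L → ¬ StartsWith x L
    L↛x (c ∷ _) (x≢c ∷ _) c≡x = x≢c (sym c≡x)

  simplePath-unique : ∀ {x z} (P Q : SimplePath x z) → steps P ≡ steps Q
  simplePath-unique {x} P Q =
    chains-unique x (steps P) (steps Q) (unique P) (chain P) (unique Q) (chain Q) (trans (ends P) (sym (ends Q)))

  module _ (connected : Connected G) (r : V) where

    toRoot : ∀ v → SimplePath v r
    toRoot v = walk⇒simplePath (connected v r)

    first : List V → V
    first []      = r
    first (a ∷ _) = a

    path-step : ∀ {v} (P : SimplePath v r) → v ≢ r →
                steps P ≡ first (steps P) ∷ steps (toRoot (first (steps P)))
    path-step (simplePath []      _              _         v≡r)  v≢r = ⊥-elim (v≢r v≡r)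
    path-step (simplePath (a ∷ L) (_ ∷ uniqueL) (_ , chainL) endsL) _ =
      cong (a ∷_) (simplePath-unique (simplePath L uniqueL chainL endsL) (toRoot a))

    path-adj : ∀ {v} (P : SimplePath v r) → v ≢ r → Adj v (first (steps P))
    path-adj (simplePath []      _ _          v≡r) v≢r = ⊥-elim (v≢r v≡r)
    path-adj (simplePath (a ∷ L) _ (v~a , _) _)   _   = v~a

    startsWith? : ∀ y L → Dec (StartsWith y L)
    startsWith? y []      = no λ ()
    startsWith? y (a ∷ _) = a ≟ y

    first-startsWith : ∀ {y} L → StartsWith y L → first L ≡ y
    first-startsWith (a ∷ _) a≡y = a≡y

    connected-acyclic⇒rooting : Rooting G
    connected-acyclic⇒rooting = record
      { root         = r
      ; parent       = parent
      ; depth        = λ v → length (steps (toRoot v))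
      ; parent-root  = cong first (simplePath-unique (toRoot r) (simplePath [] ([] ∷ []) tt refl))
      ; parent-adj   = λ v → path-adj (toRoot v)
      ; depth-parent = λ v v≢r → cong length (path-step (toRoot v) v≢r)
      ; edge-parent  = edge-parent
      }
      where
      parent : V → V
      parent v = first (steps (toRoot v))
      edge-parent : ∀ u v → Adj u v → parent u ≡ v ⊎ parent v ≡ u
      edge-parent u v u~v with startsWith? v (steps (toRoot u)) | startsWith? u (steps (toRoot v))
      ... | yes u→v | _       = inj₁ (first-startsWith _ u→v)
      ... | no _    | yes v→u = inj₂ (first-startsWith _ v→u)
      ... | no u↛v  | no v↛u  = ⊥-elim (acyclic (adjacent-paths⇒cycle u~v (toRoot u) (toRoot v) u↛v v↛u))

parity : ℕ → Bool
parity zero    = false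
parity (suc n) = not (parity n)

module _ {G : Graph} (R : Rooting G) (index : Graph.V G → ℕ)
         (index-injective : ∀ {u v} → index u ≡ index v → u ≡ v)
         (N : ℕ) (index<N : ∀ v → index v ℕ.< N) where

  open Graph G renaming (sym to adj-sym)
  open Rooting R

  colour : V → Bool
  colour v = parity (depth v)

  non-root : ∀ {u v} → parent v ≡ u → u ≢ v → v ≢ root
  non-root {u} pv≡u u≢v refl = u≢v (trans (sym pv≡u) parent-root)

  colour-parent : ∀ {u v} → parent v ≡ u → u ≢ v → colour u ≢ colour v
  colour-parent {u} {v} refl u≢v cu≡cv =
    BoolP.not-¬ refl (trans cu≡cv (cong parity (depth-parent v (non-root refl u≢v))))

  ¬mutual-parents : ∀ {u v} → parent v ≡ u → parent u ≡ v → u ≢ v → ⊥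
  ¬mutual-parents {u} {v} pv≡u pu≡v u≢v = ℕP.m≢1+n+m (depth u) {1} (begin
    depth u                  ≡⟨ depth-parent u (non-root pu≡v (u≢v ∘ sym)) ⟩
    suc (depth (parent u))   ≡⟨ cong (suc ∘ depth) pu≡v ⟩
    suc (depth v)            ≡⟨ cong suc (depth-parent v (non-root pv≡u u≢v)) ⟩
    suc (suc (depth (parent v))) ≡⟨ cong (suc ∘ suc ∘ depth) pv≡u ⟩
    suc (suc (depth u))      ∎)
    where open ≡-Reasoning

  0<N : V → 0 ℕ.< N
  0<N v = ℕP.≤-<-trans z≤n (index<N v)

  own hang : V → Interval
  own v  = natInterval (index v) 0 N (0<N v)
  hang v = natInterval (index (parent v)) (index v) (suc (index v)) (ℕP.n<1+n (index v))

  own-overlap : ∀ {u v} → Overlap (own u) (own v) → u ≡ v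
  own-overlap {u} {v} o = index-injective (proj₁ (Equivalence.to (natInterval-overlap⇔ (0<N u) (0<N v)) o))

  hang-overlap : ∀ {u v} → Overlap (hang u) (hang v) → u ≡ v
  hang-overlap {u} {v} o with Equivalence.to (natInterval-overlap⇔ (ℕP.n<1+n (index u)) (ℕP.n<1+n (index v))) o
  ... | _ , u<1+v , v<1+u = index-injective (ℕP.≤-antisym (ℕP.≤-pred u<1+v) (ℕP.≤-pred v<1+u))

  own-hang-overlap⇔ : ∀ u v → Overlap (own u) (hang v) ⇔ parent v ≡ u
  own-hang-overlap⇔ u v = ⇔.trans (natInterval-overlap⇔ (0<N u) (ℕP.n<1+n (index v)))
    (mk⇔ (λ (same , _) → sym (index-injective same)) (λ { refl → refl , s≤s z≤n , index<N v }))

  drawing : Bool → V → Interval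
  drawing c v with colour v BoolP.≟ c
  ... | yes _ = own v
  ... | no  _ = hang v

  drawing-overlap⇔ : ∀ c {u v} → u ≢ v →
    Overlap (drawing c u) (drawing c v) ⇔ ((colour u ≡ c × parent v ≡ u) ⊎ (colour v ≡ c × parent u ≡ v))
  drawing-overlap⇔ c {u} {v} u≢v with colour u BoolP.≟ c | colour v BoolP.≟ c
  ... | yes cu | yes cv = mk⇔ (⊥-elim ∘ u≢v ∘ own-overlap) λ
    { (inj₁ (_ , pv≡u)) → ⊥-elim (colour-parent pv≡u u≢v (trans cu (sym cv)))
    ; (inj₂ (_ , pu≡v)) → ⊥-elim (colour-parent pu≡v (u≢v ∘ sym) (trans cv (sym cu))) }
  ... | yes cu | no ¬cv = mk⇔ (λ o → inj₁ (cu , Equivalence.to (own-hang-overlap⇔ u v) o)) λ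
    { (inj₁ (_ , pv≡u)) → Equivalence.from (own-hang-overlap⇔ u v) pv≡u
    ; (inj₂ (cv , _))   → ⊥-elim (¬cv cv) }
  ... | no ¬cu | yes cv =
    mk⇔ (λ o → inj₂ (cv , Equivalence.to (own-hang-overlap⇔ v u) (overlap-sym {hang u} {own v} o))) λ
    { (inj₁ (cu , _))   → ⊥-elim (¬cu cu)
    ; (inj₂ (_ , pu≡v)) → overlap-sym {own v} {hang u} (Equivalence.from (own-hang-overlap⇔ v u) pu≡v) }
  ... | no ¬cu | no ¬cv = mk⇔ (⊥-elim ∘ u≢v ∘ hang-overlap) λ
    { (inj₁ (cu , _)) → ⊥-elim (¬cu cu)
    ; (inj₂ (cv , _)) → ⊥-elim (¬cv cv) }

  adj⇔parent : ∀ {u v} → u ≢ v → Adj u v ⇔ (parent v ≡ u ⊎ parent u ≡ v)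
  adj⇔parent {u} {v} u≢v = mk⇔ (Sum.swap ∘ edge-parent u v) λ
    { (inj₁ pv≡u) → adj-sym (subst (Adj v) pv≡u (parent-adj v (non-root pv≡u u≢v)))
    ; (inj₂ pu≡v) → subst (Adj u) pu≡v (parent-adj u (non-root pu≡v (u≢v ∘ sym))) }

  rootingModel : IntervalModel V Adj
  rootingModel = record { xs = drawing true ; ys = drawing false ; separated = separated ; adjacent⇔ = adjacent⇔ }
    where
    Overlaps : Bool → V → V → Set
    Overlaps c u v = Overlap (drawing c u) (drawing c v)
    true≢false : true ≢ false
    true≢false ()
    separated : ∀ u v → u ≢ v → Overlaps true u v → Overlaps false u v → ⊥
    separated u v u≢v x-overlap y-overlap
      with Equivalence.to (drawing-overlap⇔ true u≢v) x-overlap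
         | Equivalence.to (drawing-overlap⇔ false u≢v) y-overlap
    ... | inj₁ (cu , _)    | inj₁ (cu' , _)   = true≢false (trans (sym cu) cu')
    ... | inj₁ (_ , pv≡u)  | inj₂ (_ , pu≡v)  = ¬mutual-parents pv≡u pu≡v u≢v
    ... | inj₂ (_ , pu≡v)  | inj₁ (_ , pv≡u)  = ¬mutual-parents pv≡u pu≡v u≢v
    ... | inj₂ (cv , _)    | inj₂ (cv' , _)   = true≢false (trans (sym cv) cv')
    in-colour : ∀ {u v} c → Overlaps c u v → Overlaps false u v ⊎ Overlaps true u v
    in-colour false = inj₁
    in-colour true  = inj₂
    adjacent⇔ : ∀ u v → u ≢ v → Adj u v ⇔ (Overlaps false u v ⊎ Overlaps true u v)
    adjacent⇔ u v u≢v = ⇔.trans (adj⇔parent u≢v) (mk⇔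
      Sum.[ (λ pv≡u → in-colour (colour u) (Equivalence.from (overlap⇔ (colour u)) (inj₁ (refl , pv≡u))))
          , (λ pu≡v → in-colour (colour v) (Equivalence.from (overlap⇔ (colour v)) (inj₂ (refl , pu≡v)))) ]
      Sum.[ parents ∘ Equivalence.to (overlap⇔ false) , parents ∘ Equivalence.to (overlap⇔ true) ])
      where
      overlap⇔ : ∀ c → Overlaps c u v ⇔ ((colour u ≡ c × parent v ≡ u) ⊎ (colour v ≡ c × parent u ≡ v))
      overlap⇔ c = drawing-overlap⇔ c u≢v
      parents : ∀ {c} → (colour u ≡ c × parent v ≡ u) ⊎ (colour v ≡ c × parent u ≡ v) →
                parent v ≡ u ⊎ parent u ≡ v
      parents = Sum.map proj₂ proj₂

tree⇒TRVG : ∀ G → IsFinite G → IsTree G → TRVG G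
tree⇒TRVG G (zero , f) _ = (λ v → empty v) , (λ v → empty v) , (λ v → empty v)
  where
  empty : ∀ {A : Set} → Graph.V G → A
  empty v = ⊥-elim (FinP.¬Fin0 (Inverse.to f v))
tree⇒TRVG G (suc n , f) (connected , acyclic) =
  intervalModel⇒TRVG (rootingModel (connected-acyclic⇒rooting G _≟_ acyclic connected (from fzero))
                                   (toℕ ∘ to) (injective ∘ FinP.toℕ-injective) (suc n) (FinP.toℕ<n ∘ to))
  where
  open Inverse f using (to; from)
  open Injection (↔⇒↣ f) using (injective)
  _≟_ : DecidableEquality (Graph.V G)
  _≟_ = via-injection (↔⇒↣ f) FinP._≟_

theorem1p1 : (∀ (G : Graph) → IsThreshold G → TRVG G)
    × (∀ (G : Graph) → IsFinite G → IsTree G → TRVG G)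
    × (∀ (n : ℕ) → n ≥ 3 → TRVG (Cycle n))
    × IsTRVG ℤ² GridAdj
    × IsTRVG ℤ² TriAdj
    × IsTRVG ℤ² HexAdj
theorem1p1 =
    (λ G (n , b , f , adj⇔) → TRVG-transport f adj⇔ (intervalModel⇒TRVG (thresholdModel b)))
  , tree⇒TRVG
  , (λ n n≥3 → intervalModel⇒TRVG (cycleModel n n≥3))
  , intervalModel⇒TRVG gridModel
  , intervalModel⇒TRVG triModel
  , intervalModel⇒TRVG hexModel
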